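{- There is a bijection $\Phi$ from the set of P-positions of three-pile Nim to the set of cells of the three-branch Ulam–Warburton automaton such that for every P-position $P=(p_1,p_2,p_3)$ with $p_1+p_2+p_3=2n$, the cell $\Phi(P)$ is born in generation $n$, and such that $P_1$ is a parent of $P_2$ (in the Nim sense) if and only if $\Phi(P_1)$ is the parent of $\Phi(P_2)$ (in the automaton sense). In other words, the evolution graph of three-pile Nim is isomorphic, as a rooted tree graded by generation, to the evolution graph of the three-branch Ulam–Warburton automaton.
   Context: A P-position of three-pile Nim is a triple $(p_1,p_2,p_3)$ of non-negative integers with $p_1\oplus p_2\oplus p_3=0$, where $\oplus$ is bitwise XOR. For a position $P$, $\#(P)$ is its total number of counters. A P-position $P_1$ is a parent of a P-position $P_2$ (and $P_2$ a child of $P_1$) if $\#(P_1)+2=\#(P_2)$ and $P_1$ is obtained from $P_2$ by subtracting one counter from each of two distinct piles. The evolution graph of Nim has the P-positions as vertices and parent–child pairs as edges; the P-position $P$ has generation $\#(P)/2$ (the zero position $(0,0,0)$ being generation $0$). The three-branch Ulam–Warburton automaton lives on the integer grid $\mathbb{Z}^2$, with cells in the forbidden region $\{(x,y): y<0,\ y\le -|x|\}$ never allowed to be born. In generation $0$ only the cell $(0,0)$ is alive. In generation $n+1$, every grid point that is not yet alive, not in the forbidden region, and has exactly one alive neighbor among its four horizontal/vertical neighbors is born; that unique alive neighbor is its parent. The evolution graph of the automaton has the alive cells as vertices and parent–child pairs as edges. -}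

module Defs where

open import Data.Nat as ℕ using (ℕ; zero; suc; _+_; _*_; _/_; _%_)
open import Data.Bool using (Bool; true; false; _xor_; if_then_else_)
open import Data.Integer as ℤ using (ℤ; +_; -_; ∣_∣)
open import Data.Product using (Σ; _×_; _,_; ∃)
open import Data.Sum using (_⊎_)
open import Relation.Binary.PropositionalEquality using (_≡_)
open import Relation.Nullary using (¬_)

bit : ℕ → Bool
bit n = if n % 2 ℕ.≡ᵇ 1 then true else false

bitℕ : Bool → ℕ
bitℕ true  = 1
bitℕ false = 0

-- fuel-driven bitwise xor; fuel k handles numbers < 2^k
xorF : ℕ → ℕ → ℕ → ℕ
xorF zero    m n = 0
xorF (suc k) m n = bitℕ (bit m xor bit n) + 2 * xorF k (m / 2) (n / 2)

-- bitwise xor; fuel m + n suffices since m, n < 2^(m+n) (when m+n>0)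
_⊕_ : ℕ → ℕ → ℕ
m ⊕ n = xorF (m + n) m n

Pos : Set
Pos = ℕ × ℕ × ℕ

IsP : Pos → Set
IsP (a , b , c) = (a ⊕ b) ⊕ c ≡ 0

total : Pos → ℕ
total (a , b , c) = a + b + c

-- P₁ is obtained from P₂ by subtracting one counter from each of two
-- distinct piles (this also forces #(P₁) + 2 = #(P₂)).
NimParent : Pos → Pos → Set
NimParent (a , b , c) (a' , b' , c') =
    (a' ≡ suc a × b' ≡ suc b × c' ≡ c)
  ⊎ (a' ≡ suc a × b' ≡ b × c' ≡ suc c)
  ⊎ (a' ≡ a × b' ≡ suc b × c' ≡ suc c)

Cell : Set
Cell = ℤ × ℤ

origin : Cell
origin = (+ 0 , + 0)

Forbidden : Cell → Set
Forbidden (x , y) = (y ℤ.< + 0) × (y ℤ.≤ - (+ ∣ x ∣))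

data Dir : Set where
  up down left right : Dir

step : Dir → Cell → Cell
step up    (x , y) = (x , y ℤ.+ + 1)
step down  (x , y) = (x , y ℤ.- + 1)
step left  (x , y) = (x ℤ.- + 1 , y)
step right (x , y) = (x ℤ.+ + 1 , y)

Neighbour : Cell → Cell → Set
Neighbour c d = Σ Dir λ δ → step δ c ≡ d

mutual
  BornAt : ℕ → Cell → Set
  BornAt zero    c = c ≡ origin
  BornAt (suc n) c =
      ¬ AliveBy n c
    × ¬ Forbidden c
    × (Σ Dir λ δ → AliveBy n (step δ c)
                  × (∀ δ' → AliveBy n (step δ' c) → δ' ≡ δ))

  AliveBy : ℕ → Cell → Set
  AliveBy zero    c = BornAt zero c
  AliveBy (suc n) c = AliveBy n c ⊎ BornAt (suc n) c

Alive : Cell → Set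
Alive c = ∃ λ n → BornAt n c

CAParent : Cell → Cell → Set
CAParent c₁ c₂ = ∃ λ n → BornAt (suc n) c₂ × AliveBy n c₁ × Neighbour c₂ c₁

module Submission where

-- A P-position is determined by the columns of its binary expansion, each holding no ones
-- or exactly two, and its generation has a one exactly at the columns with ones; a column
-- with two ones is named by the pile lacking one. Reading the columns from the most
-- significant one, each column doubles the current cell and a column with ones then takes
-- one more step, turning left, right or not at all according to how its name moved
-- cyclically from the previous name. The Nim parent borrows from the lowest column with
-- ones, which moves the cell one step back along its heading, and neighbouring image cells
-- are always parent and child. Induction on n then identifies the image cells of generation
-- n with the cells born at n: an image cell has its parent as its only earlier neighbour and
-- is never forbidden, while a non-forbidden neighbour of an image cell that is not an image
-- cell one generation later already has two earlier image neighbours.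

open import Defs
open import Data.Nat using (ℕ; _*_)
open import Data.Product using (Σ; _×_; _,_; ∃)
open import Function.Bundles using (_⇔_)
open import Relation.Binary.PropositionalEquality using (_≡_)

module Binary where

  open import Data.Bool using (true; false; not; _xor_)
  open import Data.Nat using (zero; suc; _+_; _*_; _/_; _≤_; z≤n; s≤s)
  open import Data.Nat.DivMod using (m/n≡1+[m∸n]/n)
  open import Data.Nat.Properties
  open import Relation.Binary.PropositionalEquality

  m+[2+n]≡2+[m+n] : ∀ m n → m + (2 + n) ≡ 2 + (m + n)
  m+[2+n]≡2+[m+n] m n = trans (+-suc m (suc n)) (cong suc (+-suc m n))

  2+n/2 : ∀ n → suc (suc n) / 2 ≡ suc (n / 2)
  2+n/2 n = m/n≡1+[m∸n]/n {suc (suc n)} {2} (s≤s (s≤s z≤n))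

  bit-suc : ∀ n → bit (suc n) ≡ not (bit n)
  bit-suc zero          = refl
  bit-suc (suc zero)    = refl
  bit-suc (suc (suc n)) = bit-suc n

  bit-digit : ∀ r a → bit (bitℕ r + 2 * a) ≡ r
  bit-digit false zero = refl
  bit-digit true  zero = refl
  bit-digit false (suc a) = trans (cong (λ n → bit (0 + n)) (*-suc 2 a)) (bit-digit false a)
  bit-digit true  (suc a) = trans (cong (λ n → bit (1 + n)) (*-suc 2 a)) (bit-digit true a)

  half-digit : ∀ r a → (bitℕ r + 2 * a) / 2 ≡ a
  half-digit false zero = refl
  half-digit true  zero = refl
  half-digit r (suc a) = begin
    (bitℕ r + 2 * suc a) / 2       ≡⟨ cong (λ n → (bitℕ r + n) / 2) (*-suc 2 a) ⟩
    (bitℕ r + (2 + 2 * a)) / 2     ≡⟨ cong (_/ 2) (m+[2+n]≡2+[m+n] (bitℕ r) (2 * a)) ⟩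
    (2 + (bitℕ r + 2 * a)) / 2     ≡⟨ 2+n/2 (bitℕ r + 2 * a) ⟩
    suc ((bitℕ r + 2 * a) / 2)     ≡⟨ cong suc (half-digit r a) ⟩
    suc a                          ∎
    where open ≡-Reasoning

  bit+2*half : ∀ n → bitℕ (bit n) + 2 * (n / 2) ≡ n
  bit+2*half zero = refl
  bit+2*half (suc zero) = refl
  bit+2*half (suc (suc n)) = begin
    bitℕ (bit n) + 2 * (suc (suc n) / 2)  ≡⟨ cong (λ h → bitℕ (bit n) + 2 * h) (2+n/2 n) ⟩
    bitℕ (bit n) + 2 * suc (n / 2)        ≡⟨ cong (bitℕ (bit n) +_) (*-suc 2 (n / 2)) ⟩
    bitℕ (bit n) + (2 + 2 * (n / 2))      ≡⟨ m+[2+n]≡2+[m+n] (bitℕ (bit n)) (2 * (n / 2)) ⟩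
    2 + (bitℕ (bit n) + 2 * (n / 2))      ≡⟨ cong (2 +_) (bit+2*half n) ⟩
    2 + n                                 ∎
    where open ≡-Reasoning

  2*half≤ : ∀ n → 2 * (n / 2) ≤ n
  2*half≤ n = subst (2 * (n / 2) ≤_) (bit+2*half n) (m≤n+m (2 * (n / 2)) (bitℕ (bit n)))

  2*m≤1+n⇒m≤n : ∀ m n → 2 * m ≤ suc n → m ≤ n
  2*m≤1+n⇒m≤n zero    n _ = z≤n
  2*m≤1+n⇒m≤n (suc m) n p with subst (_≤ suc n) (*-suc 2 m) p
  ... | s≤s (s≤s q) = s≤s (2*m≤1+n⇒m≤n m _ (m≤n⇒m≤1+n q))

  halves≤ : ∀ m n k → m + n ≤ suc k → m / 2 + n / 2 ≤ k
  halves≤ m n k p = 2*m≤1+n⇒m≤n _ k (begin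
    2 * (m / 2 + n / 2)          ≡⟨ *-distribˡ-+ 2 (m / 2) (n / 2) ⟩
    2 * (m / 2) + 2 * (n / 2)    ≤⟨ +-mono-≤ (2*half≤ m) (2*half≤ n) ⟩
    m + n                        ≤⟨ p ⟩
    suc k                        ∎)
    where open ≤-Reasoning

  xorF-zero : ∀ k → xorF k 0 0 ≡ 0
  xorF-zero zero = refl
  xorF-zero (suc k) = cong (2 *_) (xorF-zero k)

  xorF-fuel : ∀ k l m n → m + n ≤ k → m + n ≤ l → xorF k m n ≡ xorF l m n
  xorF-fuel zero    l       zero zero _ _ = sym (xorF-zero l)
  xorF-fuel (suc k) zero    zero zero _ _ = xorF-zero (suc k)
  xorF-fuel (suc k) (suc l) m    n    p q =
    cong (λ h → bitℕ (bit m xor bit n) + 2 * h)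
         (xorF-fuel k l (m / 2) (n / 2) (halves≤ m n k p) (halves≤ m n l q))

  ⊕-digit : ∀ r s a b → (bitℕ r + 2 * a) ⊕ (bitℕ s + 2 * b) ≡ bitℕ (r xor s) + 2 * (a ⊕ b)
  ⊕-digit r s a b = begin
    xorF (m + n) m n
      ≡⟨ xorF-fuel (m + n) (suc (m + n)) m n ≤-refl (n≤1+n _) ⟩
    bitℕ (bit m xor bit n) + 2 * xorF (m + n) (m / 2) (n / 2)
      ≡⟨ cong₂ (λ u h → bitℕ u + 2 * h) (cong₂ _xor_ (bit-digit r a) (bit-digit s b))
               (cong₂ (xorF (m + n)) (half-digit r a) (half-digit s b)) ⟩
    bitℕ (r xor s) + 2 * xorF (m + n) a b
      ≡⟨ cong (λ h → bitℕ (r xor s) + 2 * h) (xorF-fuel (m + n) (a + b) a b a+b≤m+n ≤-refl) ⟩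
    bitℕ (r xor s) + 2 * (a ⊕ b) ∎
    where
    open ≡-Reasoning
    m = bitℕ r + 2 * a
    n = bitℕ s + 2 * b
    a+b≤m+n : a + b ≤ m + n
    a+b≤m+n = +-mono-≤ (≤-trans (m≤n*m a 2) (m≤n+m _ (bitℕ r)))
                       (≤-trans (m≤n*m b 2) (m≤n+m _ (bitℕ s)))

module Nim where

  open Binary
  open import Data.Bool using (Bool; true; false; not; _xor_)
  open import Data.Bool.Properties using (not-¬; not-distribˡ-xor; not-distribʳ-xor)
  open import Data.Empty using (⊥-elim)
  open import Data.Nat using (ℕ; zero; suc; _+_; _*_; _/_; _≤_; _<_; z≤n; s≤s)
  open import Data.Nat.Properties
  open import Data.Nat.Tactic.RingSolver using (solve-∀)
  open import Data.Product using (∃; _×_; _,_; proj₁; proj₂)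
  open import Data.Sum using (inj₁; inj₂)
  open import Function.Bundles using (_⇔_; mk⇔)
  open import Relation.Binary.PropositionalEquality
  open import Relation.Nullary using (¬_)

  ×₃-injective : ∀ {a b c a′ b′ c′ : ℕ} → (a , b , c) ≡ (a′ , b′ , c′) →
                 a ≡ a′ × b ≡ b′ × c ≡ c′
  ×₃-injective refl = refl , refl , refl

  digit-injective : ∀ r s a b → bitℕ r + 2 * a ≡ bitℕ s + 2 * b → r ≡ s × a ≡ b
  digit-injective r s a b eq =
    trans (sym (bit-digit r a)) (trans (cong bit eq) (bit-digit s b)) ,
    trans (sym (half-digit r a)) (trans (cong (_/ 2) eq) (half-digit s b))

  1+m≡2*n⇒ : ∀ m n → suc m ≡ 2 * n → ∃ λ k → n ≡ suc k × m ≡ suc (2 * k)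
  1+m≡2*n⇒ m (suc k) eq = k , refl , suc-injective (trans eq (*-suc 2 k))

  Bits : Set
  Bits = Bool × Bool × Bool

  infixr 5 _∷₂_
  _∷₂_ : Bits → Pos → Pos
  (r , s , t) ∷₂ (a , b , c) = (bitℕ r + 2 * a , bitℕ s + 2 * b , bitℕ t + 2 * c)

  ∷₂-injective : ∀ bs bs′ H H′ → bs ∷₂ H ≡ bs′ ∷₂ H′ → bs ≡ bs′ × H ≡ H′
  ∷₂-injective (r , s , t) (r′ , s′ , t′) (a , b , c) (a′ , b′ , c′) eq
    with ×₃-injective eq
  ... | e₁ , e₂ , e₃
    with digit-injective r r′ a a′ e₁ | digit-injective s s′ b b′ e₂ | digit-injective t t′ c c′ e₃
  ... | refl , refl | refl , refl | refl , refl = refl , refl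

  lowBits : Pos → Bits
  lowBits (a , b , c) = (bit a , bit b , bit c)

  halve : Pos → Pos
  halve (a , b , c) = (a / 2 , b / 2 , c / 2)

  lowBits∷₂halve : ∀ P → lowBits P ∷₂ halve P ≡ P
  lowBits∷₂halve (a , b , c) = cong₂ _,_ (bit+2*half a) (cong₂ _,_ (bit+2*half b) (bit+2*half c))

  weight : Bits → ℕ
  weight (r , s , t) = bitℕ r + bitℕ s + bitℕ t

  total-∷₂ : ∀ bs H → total (bs ∷₂ H) ≡ weight bs + 2 * total H
  total-∷₂ (r , s , t) (a , b , c) = lemma (bitℕ r) (bitℕ s) (bitℕ t) a b c
    where
    lemma : ∀ x y z a b c → x + 2 * a + (y + 2 * b) + (z + 2 * c) ≡ x + y + z + 2 * (a + b + c)
    lemma = solve-∀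

  parity : Bits → Bool
  parity (r , s , t) = (r xor s) xor t

  nimSum-∷₂ : ∀ bs H → let (a , b , c) = bs ∷₂ H ; (x , y , z) = H in
              (a ⊕ b) ⊕ c ≡ bitℕ (parity bs) + 2 * ((x ⊕ y) ⊕ z)
  nimSum-∷₂ (r , s , t) (x , y , z) =
    trans (cong (_⊕ (bitℕ t + 2 * z)) (⊕-digit r s x y)) (⊕-digit (r xor s) t (x ⊕ y) z)

  IsP-∷₂ : ∀ bs H → IsP (bs ∷₂ H) → parity bs ≡ false × IsP H
  IsP-∷₂ bs H isP with parity bs | trans (sym (nimSum-∷₂ bs H)) isP
  ... | false | eq = refl , *-cancelˡ-≡ _ 0 2 eq

  ∷₂-IsP : ∀ bs H → parity bs ≡ false → IsP H → IsP (bs ∷₂ H)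
  ∷₂-IsP bs H even isP = trans (nimSum-∷₂ bs H) (cong₂ (λ p n → bitℕ p + 2 * n) even isP)

  IsP-lowBits∷₂halve : ∀ P → IsP P → parity (lowBits P) ≡ false × IsP (halve P)
  IsP-lowBits∷₂halve P isP = IsP-∷₂ (lowBits P) (halve P) (subst IsP (sym (lowBits∷₂halve P)) isP)

  data Pile : Set where
    first second third : Pile

  grow : Pile → Pos → Pos
  grow first  (a , b , c) = (a , suc b , suc c)
  grow second (a , b , c) = (suc a , b , suc c)
  grow third  (a , b , c) = (suc a , suc b , c)

  grow-injective : ∀ j {P P′} → grow j P ≡ grow j P′ → P ≡ P′
  grow-injective first  refl = refl
  grow-injective second refl = refl
  grow-injective third  refl = refl

  NimParent⇔grow : ∀ P Q → NimParent P Q ⇔ ∃ λ j → Q ≡ grow j P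
  NimParent⇔grow (a , b , c) (a′ , b′ , c′) = mk⇔ to from
    where
    to : NimParent (a , b , c) (a′ , b′ , c′) → ∃ λ j → (a′ , b′ , c′) ≡ grow j (a , b , c)
    to (inj₁ (refl , refl , refl))        = third , refl
    to (inj₂ (inj₁ (refl , refl , refl))) = second , refl
    to (inj₂ (inj₂ (refl , refl , refl))) = first , refl
    from : (∃ λ j → (a′ , b′ , c′) ≡ grow j (a , b , c)) → NimParent (a , b , c) (a′ , b′ , c′)
    from (first  , refl) = inj₂ (inj₂ (refl , refl , refl))
    from (second , refl) = inj₂ (inj₁ (refl , refl , refl))
    from (third  , refl) = inj₁ (refl , refl , refl)

  bump : Pile → Pos → Pos
  bump first  (a , b , c) = (suc a , b , c)
  bump second (a , b , c) = (a , suc b , c)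
  bump third  (a , b , c) = (a , b , suc c)

  flip : Pile → Bits → Bits
  flip first  (r , s , t) = (not r , s , t)
  flip second (r , s , t) = (r , not s , t)
  flip third  (r , s , t) = (r , s , not t)

  lowBits-bump : ∀ j P → lowBits (bump j P) ≡ flip j (lowBits P)
  lowBits-bump first  (a , b , c) = cong (_, bit b , bit c) (bit-suc a)
  lowBits-bump second (a , b , c) = cong (λ s → bit a , s , bit c) (bit-suc b)
  lowBits-bump third  (a , b , c) = cong (λ t → bit a , bit b , t) (bit-suc c)

  parity-flip : ∀ j bs → parity (flip j bs) ≡ not (parity bs)
  parity-flip first  (r , s , t) =
    trans (cong (_xor t) (sym (not-distribˡ-xor r s))) (sym (not-distribˡ-xor (r xor s) t))
  parity-flip second (r , s , t) =
    trans (cong (_xor t) (sym (not-distribʳ-xor r s))) (sym (not-distribˡ-xor (r xor s) t))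
  parity-flip third  (r , s , t) = sym (not-distribʳ-xor (r xor s) t)

  IsP-bump : ∀ j P → IsP P → ¬ IsP (bump j P)
  IsP-bump j P isP isP′ = not-¬ (sym (proj₁ (IsP-lowBits∷₂halve P isP))) (begin
    false                        ≡⟨ proj₁ (IsP-lowBits∷₂halve (bump j P) isP′) ⟨
    parity (lowBits (bump j P))  ≡⟨ cong parity (lowBits-bump j P) ⟩
    parity (flip j (lowBits P))  ≡⟨ parity-flip j (lowBits P) ⟩
    not (parity (lowBits P))     ∎)
    where open ≡-Reasoning

  zeros : Bits
  zeros = (false , false , false)

  pairBits : Pile → Bits
  pairBits first  = (false , true , true)
  pairBits second = (true , false , true)
  pairBits third  = (true , true , false)

  -- Binary expansions of P-positions, least significant column first.
  data Code : Set where
    root : Code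
    even : Code → Code
    odd  : Pile → Code → Code

  ⟦_⟧ : Code → Pos
  ⟦ root ⟧    = (0 , 0 , 0)
  ⟦ even Q ⟧  = zeros ∷₂ ⟦ Q ⟧
  ⟦ odd j Q ⟧ = pairBits j ∷₂ ⟦ Q ⟧

  generation : Code → ℕ
  generation root      = 0
  generation (even Q)  = 2 * generation Q
  generation (odd j Q) = suc (2 * generation Q)

  pairBits≢zeros : ∀ j → pairBits j ≢ zeros
  pairBits≢zeros first  ()
  pairBits≢zeros second ()
  pairBits≢zeros third  ()

  pairBits-injective : ∀ j k → pairBits j ≡ pairBits k → j ≡ k
  pairBits-injective first  first  _ = refl
  pairBits-injective second second _ = refl
  pairBits-injective third  third  _ = refl
  pairBits-injective first  second ()
  pairBits-injective first  third  ()
  pairBits-injective second first  ()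
  pairBits-injective second third  ()
  pairBits-injective third  first  ()
  pairBits-injective third  second ()

  ⟦even⟧-injective : ∀ Q R → ⟦ even Q ⟧ ≡ ⟦ even R ⟧ → ⟦ Q ⟧ ≡ ⟦ R ⟧
  ⟦even⟧-injective Q R eq = proj₂ (∷₂-injective zeros zeros ⟦ Q ⟧ ⟦ R ⟧ eq)

  ⟦odd⟧-injective : ∀ j k Q R → ⟦ odd j Q ⟧ ≡ ⟦ odd k R ⟧ → j ≡ k × ⟦ Q ⟧ ≡ ⟦ R ⟧
  ⟦odd⟧-injective j k Q R eq with ∷₂-injective (pairBits j) (pairBits k) ⟦ Q ⟧ ⟦ R ⟧ eq
  ... | bits≡ , ⟦Q⟧≡⟦R⟧ = pairBits-injective j k bits≡ , ⟦Q⟧≡⟦R⟧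

  ⟦even⟧≢⟦odd⟧ : ∀ Q k R → ⟦ even Q ⟧ ≢ ⟦ odd k R ⟧
  ⟦even⟧≢⟦odd⟧ Q k R eq = pairBits≢zeros k (sym (proj₁ (∷₂-injective zeros (pairBits k) ⟦ Q ⟧ ⟦ R ⟧ eq)))

  ⟦odd⟧≡grow : ∀ j Q → ⟦ odd j Q ⟧ ≡ grow j ⟦ even Q ⟧
  ⟦odd⟧≡grow first  Q = refl
  ⟦odd⟧≡grow second Q = refl
  ⟦odd⟧≡grow third  Q = refl

  parity-pairBits : ∀ j → parity (pairBits j) ≡ false
  parity-pairBits first  = refl
  parity-pairBits second = refl
  parity-pairBits third  = refl

  IsP-⟦⟧ : ∀ Q → IsP ⟦ Q ⟧
  IsP-⟦⟧ root      = refl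
  IsP-⟦⟧ (even Q)  = ∷₂-IsP zeros ⟦ Q ⟧ refl (IsP-⟦⟧ Q)
  IsP-⟦⟧ (odd j Q) = ∷₂-IsP (pairBits j) ⟦ Q ⟧ (parity-pairBits j) (IsP-⟦⟧ Q)

  weight-pairBits : ∀ j → weight (pairBits j) ≡ 2
  weight-pairBits first  = refl
  weight-pairBits second = refl
  weight-pairBits third  = refl

  total-⟦⟧ : ∀ Q → total ⟦ Q ⟧ ≡ 2 * generation Q
  total-⟦⟧ root      = refl
  total-⟦⟧ (even Q)  = trans (total-∷₂ zeros ⟦ Q ⟧) (cong (2 *_) (total-⟦⟧ Q))
  total-⟦⟧ (odd j Q) = begin
    total (pairBits j ∷₂ ⟦ Q ⟧)                  ≡⟨ total-∷₂ (pairBits j) ⟦ Q ⟧ ⟩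
    weight (pairBits j) + 2 * total ⟦ Q ⟧        ≡⟨ cong₂ _+_ (weight-pairBits j) (cong (2 *_) (total-⟦⟧ Q)) ⟩
    2 + 2 * (2 * generation Q)                   ≡⟨ *-suc 2 (2 * generation Q) ⟨
    2 * suc (2 * generation Q)                   ∎
    where open ≡-Reasoning

  ⟦⟧-generation : ∀ Q R → ⟦ Q ⟧ ≡ ⟦ R ⟧ → generation Q ≡ generation R
  ⟦⟧-generation Q R eq =
    *-cancelˡ-≡ _ _ 2 (trans (sym (total-⟦⟧ Q)) (trans (cong total eq) (total-⟦⟧ R)))

  -- On the columns of odd parity, which P-positions lack, the result is junk.
  pushDigit : Bits → Code → Code
  pushDigit (false , false , false) Q = even Q
  pushDigit (false , true  , true)  Q = odd first Q
  pushDigit (true  , false , true)  Q = odd second Q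
  pushDigit (true  , true  , false) Q = odd third Q
  pushDigit _                       Q = root

  ⟦pushDigit⟧ : ∀ bs Q → parity bs ≡ false → ⟦ pushDigit bs Q ⟧ ≡ bs ∷₂ ⟦ Q ⟧
  ⟦pushDigit⟧ (false , false , false) Q _ = refl
  ⟦pushDigit⟧ (false , true  , true)  Q _ = refl
  ⟦pushDigit⟧ (true  , false , true)  Q _ = refl
  ⟦pushDigit⟧ (true  , true  , false) Q _ = refl
  ⟦pushDigit⟧ (false , false , true)  Q ()
  ⟦pushDigit⟧ (false , true  , false) Q ()
  ⟦pushDigit⟧ (true  , false , false) Q ()
  ⟦pushDigit⟧ (true  , true  , true)  Q ()

  decode : ℕ → Pos → Code
  decode zero    P = root
  decode (suc k) P = pushDigit (lowBits P) (decode k (halve P))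

  code : Pos → Code
  code P = decode (total P) P

  total-halve≤ : ∀ P k → total P ≤ suc k → total (halve P) ≤ k
  total-halve≤ P k le = 2*m≤1+n⇒m≤n _ k (begin
    2 * total (halve P)                            ≤⟨ m≤n+m _ (weight (lowBits P)) ⟩
    weight (lowBits P) + 2 * total (halve P)       ≡⟨ total-∷₂ (lowBits P) (halve P) ⟨
    total (lowBits P ∷₂ halve P)                   ≡⟨ cong total (lowBits∷₂halve P) ⟩
    total P                                        ≤⟨ le ⟩
    suc k                                          ∎)
    where open ≤-Reasoning

  ⟦decode⟧ : ∀ k P → IsP P → total P ≤ k → ⟦ decode k P ⟧ ≡ P
  ⟦decode⟧ zero    (zero , zero , zero) _ _ = refl
  ⟦decode⟧ (suc k) P isP le = begin
    ⟦ pushDigit (lowBits P) (decode k (halve P)) ⟧  ≡⟨ ⟦pushDigit⟧ (lowBits P) _ even-column ⟩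
    lowBits P ∷₂ ⟦ decode k (halve P) ⟧             ≡⟨ cong (lowBits P ∷₂_) halves-decoded ⟩
    lowBits P ∷₂ halve P                            ≡⟨ lowBits∷₂halve P ⟩
    P                                               ∎
    where
    open ≡-Reasoning
    even-column = proj₁ (IsP-lowBits∷₂halve P isP)
    halves-decoded : ⟦ decode k (halve P) ⟧ ≡ halve P
    halves-decoded = ⟦decode⟧ k (halve P) (proj₂ (IsP-lowBits∷₂halve P isP)) (total-halve≤ P k le)

  ⟦code⟧ : ∀ P → IsP P → ⟦ code P ⟧ ≡ P
  ⟦code⟧ P isP = ⟦decode⟧ (total P) P isP ≤-refl

  generation-code : ∀ P n → IsP P → total P ≡ 2 * n → generation (code P) ≡ n
  generation-code P n isP eq =
    *-cancelˡ-≡ _ _ 2 (trans (sym (total-⟦⟧ (code P))) (trans (cong total (⟦code⟧ P isP)) eq))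

  lastPile : Code → Pile
  lastPile root      = first
  lastPile (even Q)  = lastPile Q
  lastPile (odd j Q) = j

  parentCode : Code → Code
  parentCode root      = root
  parentCode (even Q)  = odd (lastPile Q) (parentCode Q)
  parentCode (odd j Q) = even Q

  0<2*n⇒0<n : ∀ n → 0 < 2 * n → 0 < n
  0<2*n⇒0<n (suc n) _ = s≤s z≤n

  generation-parentCode : ∀ Q → 0 < generation Q → suc (generation (parentCode Q)) ≡ generation Q
  generation-parentCode (odd j Q) _   = refl
  generation-parentCode (even Q)  pos = begin
    2 + 2 * generation (parentCode Q)   ≡⟨ *-suc 2 _ ⟨
    2 * suc (generation (parentCode Q)) ≡⟨ cong (2 *_) (generation-parentCode Q (0<2*n⇒0<n _ pos)) ⟩
    2 * generation Q                    ∎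
    where open ≡-Reasoning

  zeros∷₂grow : ∀ j H → zeros ∷₂ grow j H ≡ grow j (pairBits j ∷₂ H)
  zeros∷₂grow first  (a , b , c) = cong₂ (λ y z → 2 * a , y , z) (*-suc 2 b) (*-suc 2 c)
  zeros∷₂grow second (a , b , c) = cong₂ (λ x z → x , 2 * b , z) (*-suc 2 a) (*-suc 2 c)
  zeros∷₂grow third  (a , b , c) = cong₂ (λ x y → x , y , 2 * c) (*-suc 2 a) (*-suc 2 b)

  ⟦⟧≡grow-parentCode : ∀ Q → 0 < generation Q → ⟦ Q ⟧ ≡ grow (lastPile Q) ⟦ parentCode Q ⟧
  ⟦⟧≡grow-parentCode (odd j Q) _   = ⟦odd⟧≡grow j Q
  ⟦⟧≡grow-parentCode (even Q)  pos =
    trans (cong (zeros ∷₂_) (⟦⟧≡grow-parentCode Q (0<2*n⇒0<n _ pos)))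
          (zeros∷₂grow (lastPile Q) ⟦ parentCode Q ⟧)

  grow≡zeros∷₂⇒ : ∀ j {P H} → grow j P ≡ zeros ∷₂ H →
                  ∃ λ H′ → P ≡ pairBits j ∷₂ H′ × H ≡ grow j H′
  grow≡zeros∷₂⇒ first {a , b , c} {x , y , z} eq with ×₃-injective eq
  ... | refl , eb , ec with 1+m≡2*n⇒ b y eb | 1+m≡2*n⇒ c z ec
  ... | y′ , refl , refl | z′ , refl , refl = (x , y′ , z′) , refl , refl
  grow≡zeros∷₂⇒ second {a , b , c} {x , y , z} eq with ×₃-injective eq
  ... | ea , refl , ec with 1+m≡2*n⇒ a x ea | 1+m≡2*n⇒ c z ec
  ... | x′ , refl , refl | z′ , refl , refl = (x′ , y , z′) , refl , refl
  grow≡zeros∷₂⇒ third {a , b , c} {x , y , z} eq with ×₃-injective eq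
  ... | ea , eb , refl with 1+m≡2*n⇒ a x ea | 1+m≡2*n⇒ b y eb
  ... | x′ , refl , refl | y′ , refl , refl = (x′ , y′ , z) , refl , refl

  IsP-∷₂-bump : ∀ l k H → IsP (pairBits l ∷₂ H) → ¬ IsP (bump k H)
  IsP-∷₂-bump l k H isP = IsP-bump k H (proj₂ (IsP-∷₂ (pairBits l) H isP))

  -- Otherwise the halves of the two P-positions would differ in one counter of one pile.
  grow≡pairBits∷₂⇒ : ∀ i j {P H} → IsP P → IsP H → grow i P ≡ pairBits j ∷₂ H → i ≡ j
  grow≡pairBits∷₂⇒ first first _ _ _ = refl
  grow≡pairBits∷₂⇒ second second _ _ _ = refl
  grow≡pairBits∷₂⇒ third third _ _ _ = refl
  grow≡pairBits∷₂⇒ first second {a , b , c} {x , y , z} isP isH eq with ×₃-injective eq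
  ... | refl , eb , refl with 1+m≡2*n⇒ b y eb
  ... | y′ , refl , refl = ⊥-elim (IsP-∷₂-bump third second (x , y′ , z) isP isH)
  grow≡pairBits∷₂⇒ first third {a , b , c} {x , y , z} isP isH eq with ×₃-injective eq
  ... | refl , refl , ec with 1+m≡2*n⇒ c z ec
  ... | z′ , refl , refl = ⊥-elim (IsP-∷₂-bump second third (x , y , z′) isP isH)
  grow≡pairBits∷₂⇒ second first {a , b , c} {x , y , z} isP isH eq with ×₃-injective eq
  ... | ea , refl , refl with 1+m≡2*n⇒ a x ea
  ... | x′ , refl , refl = ⊥-elim (IsP-∷₂-bump third first (x′ , y , z) isP isH)
  grow≡pairBits∷₂⇒ second third {a , b , c} {x , y , z} isP isH eq with ×₃-injective eq
  ... | refl , refl , ec with 1+m≡2*n⇒ c z ec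
  ... | z′ , refl , refl = ⊥-elim (IsP-∷₂-bump first third (x , y , z′) isP isH)
  grow≡pairBits∷₂⇒ third first {a , b , c} {x , y , z} isP isH eq with ×₃-injective eq
  ... | ea , refl , refl with 1+m≡2*n⇒ a x ea
  ... | x′ , refl , refl = ⊥-elim (IsP-∷₂-bump second first (x′ , y , z) isP isH)
  grow≡pairBits∷₂⇒ third second {a , b , c} {x , y , z} isP isH eq with ×₃-injective eq
  ... | refl , eb , refl with 1+m≡2*n⇒ b y eb
  ... | y′ , refl , refl = ⊥-elim (IsP-∷₂-bump first second (x , y′ , z) isP isH)

  grow⇒parentCode : ∀ Q i P → IsP P → grow i P ≡ ⟦ Q ⟧ →
                    P ≡ ⟦ parentCode Q ⟧ × i ≡ lastPile Q × 0 < generation Q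
  grow⇒parentCode root      first  _ _ ()
  grow⇒parentCode root      second _ _ ()
  grow⇒parentCode root      third  _ _ ()
  grow⇒parentCode (odd j Q) i      P isP eq
    with grow≡pairBits∷₂⇒ i j {P} {⟦ Q ⟧} isP (IsP-⟦⟧ Q) eq
  ... | refl = grow-injective i (trans eq (⟦odd⟧≡grow i Q)) , refl , s≤s z≤n
  grow⇒parentCode (even Q)  i      P isP eq with grow≡zeros∷₂⇒ i {P} {⟦ Q ⟧} eq
  ... | H , refl , eq′ with grow⇒parentCode Q i H (proj₂ (IsP-∷₂ (pairBits i) H isP)) (sym eq′)
  ... | refl , refl , pos = refl , refl , *-monoʳ-< 2 pos

module Turning where

  open Nim using (Pile; first; second; third)
  open import Data.Empty using (⊥-elim)
  open import Data.Product using (∃; _,_)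
  open import Data.Sum using (_⊎_; inj₁; inj₂)
  open import Relation.Binary.PropositionalEquality

  opposite : Dir → Dir
  opposite up    = down
  opposite down  = up
  opposite left  = right
  opposite right = left

  opposite-involutive : ∀ d → opposite (opposite d) ≡ d
  opposite-involutive up    = refl
  opposite-involutive down  = refl
  opposite-involutive left  = refl
  opposite-involutive right = refl

  opposite-injective : ∀ {d e} → opposite d ≡ opposite e → d ≡ e
  opposite-injective {d} {e} eq =
    trans (sym (opposite-involutive d)) (trans (cong opposite eq) (opposite-involutive e))

  opposite-≢ : ∀ {u v} → u ≢ v → opposite u ≢ opposite v
  opposite-≢ u≢v eq = u≢v (opposite-injective eq)

  data Turn : Set where
    straight leftward rightward : Turn

  steer : Turn → Dir → Dir
  steer straight  d     = d
  steer leftward  up    = left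
  steer leftward  left  = down
  steer leftward  down  = right
  steer leftward  right = up
  steer rightward up    = right
  steer rightward right = down
  steer rightward down  = left
  steer rightward left  = up

  steer≢opposite : ∀ t d → steer t d ≢ opposite d
  steer≢opposite straight  up    ()
  steer≢opposite straight  down  ()
  steer≢opposite straight  left  ()
  steer≢opposite straight  right ()
  steer≢opposite leftward  up    ()
  steer≢opposite leftward  down  ()
  steer≢opposite leftward  left  ()
  steer≢opposite leftward  right ()
  steer≢opposite rightward up    ()
  steer≢opposite rightward down  ()
  steer≢opposite rightward left  ()
  steer≢opposite rightward right ()

  steer-or-reverse : ∀ d v → v ≡ opposite d ⊎ ∃ λ t → steer t d ≡ v
  steer-or-reverse up    up    = inj₂ (straight , refl)
  steer-or-reverse up    left  = inj₂ (leftward , refl)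
  steer-or-reverse up    right = inj₂ (rightward , refl)
  steer-or-reverse up    down  = inj₁ refl
  steer-or-reverse down  down  = inj₂ (straight , refl)
  steer-or-reverse down  right = inj₂ (leftward , refl)
  steer-or-reverse down  left  = inj₂ (rightward , refl)
  steer-or-reverse down  up    = inj₁ refl
  steer-or-reverse left  left  = inj₂ (straight , refl)
  steer-or-reverse left  down  = inj₂ (leftward , refl)
  steer-or-reverse left  up    = inj₂ (rightward , refl)
  steer-or-reverse left  right = inj₁ refl
  steer-or-reverse right right = inj₂ (straight , refl)
  steer-or-reverse right up    = inj₂ (leftward , refl)
  steer-or-reverse right down  = inj₂ (rightward , refl)
  steer-or-reverse right left  = inj₁ refl

  leftward≢straight : ∀ d → steer leftward d ≢ d
  leftward≢straight up    ()
  leftward≢straight down  ()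
  leftward≢straight left  ()
  leftward≢straight right ()

  rightward≢straight : ∀ d → steer rightward d ≢ d
  rightward≢straight up    ()
  rightward≢straight down  ()
  rightward≢straight left  ()
  rightward≢straight right ()

  leftward≢rightward : ∀ d → steer leftward d ≢ steer rightward d
  leftward≢rightward up    ()
  leftward≢rightward down  ()
  leftward≢rightward left  ()
  leftward≢rightward right ()

  steer-injective : ∀ d t t′ → steer t d ≡ steer t′ d → t ≡ t′
  steer-injective d straight  straight  _  = refl
  steer-injective d leftward  leftward  _  = refl
  steer-injective d rightward rightward _  = refl
  steer-injective d straight  leftward  eq = ⊥-elim (leftward≢straight d (sym eq))
  steer-injective d straight  rightward eq = ⊥-elim (rightward≢straight d (sym eq))
  steer-injective d leftward  straight  eq = ⊥-elim (leftward≢straight d eq)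
  steer-injective d leftward  rightward eq = ⊥-elim (leftward≢rightward d eq)
  steer-injective d rightward straight  eq = ⊥-elim (rightward≢straight d eq)
  steer-injective d rightward leftward  eq = ⊥-elim (leftward≢rightward d (sym eq))

  -- The three piles, cyclically ordered, encode the three turns relative to the previous pile.
  turnBetween : Pile → Pile → Turn
  turnBetween first  first  = straight
  turnBetween second second = straight
  turnBetween third  third  = straight
  turnBetween first  second = leftward
  turnBetween second third  = leftward
  turnBetween third  first  = leftward
  turnBetween first  third  = rightward
  turnBetween second first  = rightward
  turnBetween third  second = rightward

  shiftPile : Turn → Pile → Pile
  shiftPile straight  a      = a
  shiftPile leftward  first  = second
  shiftPile leftward  second = third
  shiftPile leftward  third  = first
  shiftPile rightward first  = third
  shiftPile rightward second = first
  shiftPile rightward third  = second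

  turnBetween-shiftPile : ∀ t a → turnBetween a (shiftPile t a) ≡ t
  turnBetween-shiftPile straight  first  = refl
  turnBetween-shiftPile straight  second = refl
  turnBetween-shiftPile straight  third  = refl
  turnBetween-shiftPile leftward  first  = refl
  turnBetween-shiftPile leftward  second = refl
  turnBetween-shiftPile leftward  third  = refl
  turnBetween-shiftPile rightward first  = refl
  turnBetween-shiftPile rightward second = refl
  turnBetween-shiftPile rightward third  = refl

  turnBetween-self : ∀ a → turnBetween a a ≡ straight
  turnBetween-self = turnBetween-shiftPile straight

  shiftPile-turnBetween : ∀ a b → shiftPile (turnBetween a b) a ≡ b
  shiftPile-turnBetween first  first  = refl
  shiftPile-turnBetween first  second = refl
  shiftPile-turnBetween first  third  = refl
  shiftPile-turnBetween second first  = refl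
  shiftPile-turnBetween second second = refl
  shiftPile-turnBetween second third  = refl
  shiftPile-turnBetween third  first  = refl
  shiftPile-turnBetween third  second = refl
  shiftPile-turnBetween third  third  = refl

  turnBetween-injective : ∀ a b b′ → turnBetween a b ≡ turnBetween a b′ → b ≡ b′
  turnBetween-injective a b b′ eq =
    trans (sym (shiftPile-turnBetween a b))
          (trans (cong (λ t → shiftPile t a) eq) (shiftPile-turnBetween a b′))

module Lattice where

  open Binary using (bit-suc; bit-digit; half-digit; 2+n/2)
  open Turning using (opposite; opposite-involutive; opposite-injective)
  open import Data.Bool using (Bool; true; false; not)
  open import Data.Bool.Properties using (not-involutive)
  open import Data.Empty using (⊥-elim)
  open import Data.Integer
    using (ℤ; +_; -[1+_]; +0; _+_; _-_; -_; ∣_∣; _≤_; +≤+; -≤+; -≤-; -<+; +<+)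
  open import Data.Integer.Properties
    using (+-identityʳ; +-assoc; +-comm; +-mono-<; +-mono-≤; +-monoʳ-≤; +-monoˡ-≤; ≤-trans; ≤-refl;
           ≤-reflexive; <⇒≱; neg-distrib-+; i≤i+j; ∣-i∣≡∣i∣; +-inverseˡ; ∣i+j∣≤∣i∣+∣j∣; module ≤-Reasoning)
  open import Data.Integer.Tactic.RingSolver using (solve-∀)
  import Data.Nat as ℕ
  import Data.Nat.Properties as ℕ
  open import Data.Product using (_×_; _,_; proj₁; proj₂)
  open import Data.Sum using (_⊎_; inj₁; inj₂)
  open import Relation.Binary.PropositionalEquality
  open import Relation.Nullary using (¬_)

  odd? : ℤ → Bool
  odd? (+ n)    = bit n
  odd? -[1+ n ] = bit (ℕ.suc n)

  -- Only meaningful on even arguments.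
  half : ℤ → ℤ
  half (+ n)    = + (n ℕ./ 2)
  half -[1+ n ] = - (+ (ℕ.suc n ℕ./ 2))

  n+n≡2*n : ∀ n → n ℕ.+ n ≡ 0 ℕ.+ 2 ℕ.* n
  n+n≡2*n n = cong (n ℕ.+_) (sym (ℕ.+-identityʳ n))

  odd?-double : ∀ i → odd? (i + i) ≡ false
  odd?-double (+ n)    = trans (cong bit (n+n≡2*n n)) (bit-digit false n)
  odd?-double -[1+ n ] = odd?-double (+ n)

  half-double : ∀ i → half (i + i) ≡ i
  half-double (+ n)    = cong +_ (trans (cong (ℕ._/ 2) (n+n≡2*n n)) (half-digit false n))
  half-double -[1+ n ] = cong (λ m → - (+ m)) (trans (2+n/2 (n ℕ.+ n)) (cong ℕ.suc (half-n+n)))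
    where
    half-n+n : (n ℕ.+ n) ℕ./ 2 ≡ n
    half-n+n = trans (cong (ℕ._/ 2) (n+n≡2*n n)) (half-digit false n)

  odd?-suc : ∀ i → odd? (i + + 1) ≡ not (odd? i)
  odd?-suc (+ n)          = trans (cong bit (ℕ.+-comm n 1)) (bit-suc n)
  odd?-suc -[1+ 0 ]       = refl
  odd?-suc -[1+ ℕ.suc n ] = bit-suc n

  odd?-pred : ∀ i → odd? (i - + 1) ≡ not (odd? i)
  odd?-pred i = begin
    odd? (i - + 1)                    ≡⟨ not-involutive _ ⟨
    not (not (odd? (i - + 1)))        ≡⟨ cong not (odd?-suc (i - + 1)) ⟨
    not (odd? ((i - + 1) + + 1))      ≡⟨ cong (λ j → not (odd? j)) (lemma i) ⟩
    not (odd? i)                      ∎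
    where
    open ≡-Reasoning
    lemma : ∀ i → (i - + 1) + + 1 ≡ i
    lemma = solve-∀

  i+i≡j+j+k⇒ : ∀ i j k → i + i ≡ (j + j) + k → odd? k ≡ false × i ≡ j + half k
  i+i≡j+j+k⇒ i j k eq = subst (λ m → odd? m ≡ false) w+w≡k (odd?-double w) , (begin
    i                 ≡⟨ j+w≡i i j ⟨
    j + w             ≡⟨ cong (λ m → j + m) (half-double w) ⟨
    j + half (w + w)  ≡⟨ cong (λ m → j + half m) w+w≡k ⟩
    j + half k        ∎)
    where
    open ≡-Reasoning
    w = i - j
    rearrange : ∀ i j → (i - j) + (i - j) ≡ (i + i) - (j + j)
    rearrange = solve-∀
    cancel : ∀ j k → ((j + j) + k) - (j + j) ≡ k
    cancel = solve-∀
    j+w≡i : ∀ i j → j + (i - j) ≡ i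
    j+w≡i = solve-∀
    w+w≡k : w + w ≡ k
    w+w≡k = trans (rearrange i j) (trans (cong (_- (j + j)) eq) (cancel j k))

  infixl 6 _+ᶜ_
  _+ᶜ_ : Cell → Cell → Cell
  (a , b) +ᶜ (c , d) = (a + c , b + d)

  +ᶜ-assoc : ∀ a b c → (a +ᶜ b) +ᶜ c ≡ a +ᶜ (b +ᶜ c)
  +ᶜ-assoc (a₁ , a₂) (b₁ , b₂) (c₁ , c₂) = cong₂ _,_ (+-assoc a₁ b₁ c₁) (+-assoc a₂ b₂ c₂)

  +ᶜ-comm : ∀ a b → a +ᶜ b ≡ b +ᶜ a
  +ᶜ-comm (a₁ , a₂) (b₁ , b₂) = cong₂ _,_ (+-comm a₁ b₁) (+-comm a₂ b₂)

  +ᶜ-identityʳ : ∀ a → a +ᶜ origin ≡ a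
  +ᶜ-identityʳ (a₁ , a₂) = cong₂ _,_ (+-identityʳ a₁) (+-identityʳ a₂)

  double : Cell → Cell
  double (x , y) = (x + x , y + y)

  halfᶜ : Cell → Cell
  halfᶜ (x , y) = (half x , half y)

  double-+ᶜ : ∀ a b → double (a +ᶜ b) ≡ double a +ᶜ double b
  double-+ᶜ (a₁ , a₂) (b₁ , b₂) = cong₂ _,_ (lemma a₁ b₁) (lemma a₂ b₂)
    where
    lemma : ∀ a b → (a + b) + (a + b) ≡ (a + a) + (b + b)
    lemma = solve-∀

  double-injective : ∀ {p q} → double p ≡ double q → p ≡ q
  double-injective {p} {q} eq = trans (sym (halfᶜ-double p)) (trans (cong halfᶜ eq) (halfᶜ-double q))
    where
    halfᶜ-double : ∀ c → halfᶜ (double c) ≡ c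
    halfᶜ-double (x , y) = cong₂ _,_ (half-double x) (half-double y)

  double≡double+ᶜ⇒ : ∀ {q r o} → double q ≡ double r +ᶜ o →
                     odd? (proj₁ o) ≡ false × odd? (proj₂ o) ≡ false × q ≡ r +ᶜ halfᶜ o
  double≡double+ᶜ⇒ {qx , qy} {rx , ry} {ox , oy} eq
    with i+i≡j+j+k⇒ qx rx ox (cong proj₁ eq) | i+i≡j+j+k⇒ qy ry oy (cong proj₂ eq)
  ... | ex , hx | ey , hy = ex , ey , cong₂ _,_ hx hy

  offset : Dir → Cell
  offset up    = (+0 , + 1)
  offset down  = (+0 , -[1+ 0 ])
  offset left  = (-[1+ 0 ] , +0)
  offset right = (+ 1 , +0)

  step≡+ᶜoffset : ∀ δ c → step δ c ≡ c +ᶜ offset δ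
  step≡+ᶜoffset up    (x , y) = cong (_, y + + 1) (sym (+-identityʳ x))
  step≡+ᶜoffset down  (x , y) = cong (_, y - + 1) (sym (+-identityʳ x))
  step≡+ᶜoffset left  (x , y) = cong (x - + 1 ,_) (sym (+-identityʳ y))
  step≡+ᶜoffset right (x , y) = cong (x + + 1 ,_) (sym (+-identityʳ y))

  step∘step≡+ᶜ : ∀ u v c → step v (step u c) ≡ c +ᶜ (offset u +ᶜ offset v)
  step∘step≡+ᶜ u v c = begin
    step v (step u c)               ≡⟨ step≡+ᶜoffset v (step u c) ⟩
    step u c +ᶜ offset v            ≡⟨ cong (_+ᶜ offset v) (step≡+ᶜoffset u c) ⟩
    c +ᶜ offset u +ᶜ offset v       ≡⟨ +ᶜ-assoc c (offset u) (offset v) ⟩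
    c +ᶜ (offset u +ᶜ offset v)     ∎
    where open ≡-Reasoning

  step-comm : ∀ u v c → step v (step u c) ≡ step u (step v c)
  step-comm u v c = begin
    step v (step u c)               ≡⟨ step∘step≡+ᶜ u v c ⟩
    c +ᶜ (offset u +ᶜ offset v)     ≡⟨ cong (c +ᶜ_) (+ᶜ-comm (offset u) (offset v)) ⟩
    c +ᶜ (offset v +ᶜ offset u)     ≡⟨ step∘step≡+ᶜ v u c ⟨
    step u (step v c)               ∎
    where open ≡-Reasoning

  step-opposite : ∀ δ c → step (opposite δ) (step δ c) ≡ c
  step-opposite δ c = begin
    step (opposite δ) (step δ c)          ≡⟨ step∘step≡+ᶜ δ (opposite δ) c ⟩
    c +ᶜ (offset δ +ᶜ offset (opposite δ)) ≡⟨ cong (c +ᶜ_) (offset-opposite δ) ⟩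
    c +ᶜ origin                           ≡⟨ +ᶜ-identityʳ c ⟩
    c                                     ∎
    where
    open ≡-Reasoning
    offset-opposite : ∀ δ → offset δ +ᶜ offset (opposite δ) ≡ origin
    offset-opposite up    = refl
    offset-opposite down  = refl
    offset-opposite left  = refl
    offset-opposite right = refl

  step-opposite′ : ∀ δ c → step δ (step (opposite δ) c) ≡ c
  step-opposite′ δ c = subst (λ d → step d (step (opposite δ) c) ≡ c) (opposite-involutive δ)
                             (step-opposite (opposite δ) c)

  double-step : ∀ δ c → double (step δ c) ≡ step δ (step δ (double c))
  double-step δ c = begin
    double (step δ c)                 ≡⟨ cong double (step≡+ᶜoffset δ c) ⟩
    double (c +ᶜ offset δ)            ≡⟨ double-+ᶜ c (offset δ) ⟩
    double c +ᶜ double (offset δ)     ≡⟨ cong (double c +ᶜ_) (double-offset δ) ⟩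
    double c +ᶜ (offset δ +ᶜ offset δ) ≡⟨ step∘step≡+ᶜ δ δ (double c) ⟨
    step δ (step δ (double c))        ∎
    where
    open ≡-Reasoning
    double-offset : ∀ δ → double (offset δ) ≡ offset δ +ᶜ offset δ
    double-offset up    = refl
    double-offset down  = refl
    double-offset left  = refl
    double-offset right = refl

  -- Halving the equation leaves only the two collinear cases; the perpendicular ones make a coordinate odd.
  double≡step∘step∘double⇒ : ∀ q δ u r → double q ≡ step δ (step u (double r)) →
                             (δ ≡ opposite u × q ≡ r) ⊎ (δ ≡ u × q ≡ step u r)
  double≡step∘step∘double⇒ q δ u r eq =
    cases δ u (double≡double+ᶜ⇒ {q} {r} {offset u +ᶜ offset δ}
                                 (trans eq (step∘step≡+ᶜ u δ (double r))))
    where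
    cases : ∀ δ u → let o = offset u +ᶜ offset δ in
            odd? (proj₁ o) ≡ false × odd? (proj₂ o) ≡ false × q ≡ r +ᶜ halfᶜ o →
            (δ ≡ opposite u × q ≡ r) ⊎ (δ ≡ u × q ≡ step u r)
    cases up    up    (_ , _ , h) = inj₂ (refl , trans h (sym (step≡+ᶜoffset up r)))
    cases down  down  (_ , _ , h) = inj₂ (refl , trans h (sym (step≡+ᶜoffset down r)))
    cases left  left  (_ , _ , h) = inj₂ (refl , trans h (sym (step≡+ᶜoffset left r)))
    cases right right (_ , _ , h) = inj₂ (refl , trans h (sym (step≡+ᶜoffset right r)))
    cases up    down  (_ , _ , h) = inj₁ (refl , trans h (+ᶜ-identityʳ r))
    cases down  up    (_ , _ , h) = inj₁ (refl , trans h (+ᶜ-identityʳ r))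
    cases left  right (_ , _ , h) = inj₁ (refl , trans h (+ᶜ-identityʳ r))
    cases right left  (_ , _ , h) = inj₁ (refl , trans h (+ᶜ-identityʳ r))
    cases up    left  (() , _)
    cases up    right (() , _)
    cases down  left  (() , _)
    cases down  right (() , _)
    cases left  up    (() , _)
    cases left  down  (() , _)
    cases right up    (() , _)
    cases right down  (() , _)

  step∘double≡step∘double⇒ : ∀ u q δ r → step u (double q) ≡ step δ (double r) →
                             (u ≡ δ × q ≡ r) ⊎ (δ ≡ opposite u × r ≡ step u q)
  step∘double≡step∘double⇒ u q δ r eq
    with double≡step∘step∘double⇒ q (opposite u) δ r
           (trans (sym (step-opposite u (double q))) (cong (step (opposite u)) eq))
  ... | inj₁ (u′≡δ′ , q≡r) = inj₁ (opposite-injective u′≡δ′ , q≡r)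
  ... | inj₂ (refl , refl) = inj₂ (refl , sym (step-opposite′ u r))

  colour : Cell → Bool
  colour (x , y) = odd? (x + y)

  colour-step : ∀ δ c → colour (step δ c) ≡ not (colour c)
  colour-step up    (x , y) = trans (cong odd? (lemma x y)) (odd?-suc (x + y))
    where
    lemma : ∀ x y → x + (y + + 1) ≡ (x + y) + + 1
    lemma = solve-∀
  colour-step down  (x , y) = trans (cong odd? (lemma x y)) (odd?-pred (x + y))
    where
    lemma : ∀ x y → x + (y - + 1) ≡ (x + y) - + 1
    lemma = solve-∀
  colour-step left  (x , y) = trans (cong odd? (lemma x y)) (odd?-pred (x + y))
    where
    lemma : ∀ x y → (x - + 1) + y ≡ (x + y) - + 1
    lemma = solve-∀
  colour-step right (x , y) = trans (cong odd? (lemma x y)) (odd?-suc (x + y))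
    where
    lemma : ∀ x y → (x + + 1) + y ≡ (x + y) + + 1
    lemma = solve-∀

  colour-double : ∀ c → colour (double c) ≡ false
  colour-double (x , y) = trans (cong odd? (lemma x y)) (odd?-double (x + y))
    where
    lemma : ∀ x y → (x + x) + (y + y) ≡ (x + y) + (x + y)
    lemma = solve-∀

  step∘double≢double : ∀ δ p q → step δ (double p) ≢ double q
  true≢false : true ≢ false
  true≢false ()

  step∘double≢double δ p q eq = true≢false (begin
      true                              ≡⟨ cong not (colour-double p) ⟨
      not (colour (double p))           ≡⟨ colour-step δ (double p) ⟨
      colour (step δ (double p))        ≡⟨ cong colour eq ⟩
      colour (double q)                 ≡⟨ colour-double q ⟩
      false                             ∎)
    where open ≡-Reasoning

  step∘double≢step∘step∘double : ∀ u q δ v r → step u (double q) ≢ step δ (step v (double r))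
  step∘double≢step∘step∘double u q δ v r eq = true≢false (begin
      true                                 ≡⟨ cong not (colour-double q) ⟨
      not (colour (double q))              ≡⟨ colour-step u (double q) ⟨
      colour (step u (double q))           ≡⟨ cong colour eq ⟩
      colour (step δ (step v (double r)))  ≡⟨ colour-step δ _ ⟩
      not (colour (step v (double r)))     ≡⟨ cong not (colour-step v (double r)) ⟩
      not (not (colour (double r)))        ≡⟨ cong (λ b → not (not b)) (colour-double r) ⟩
      false                                ∎)
    where open ≡-Reasoning

  ∣i+i∣ : ∀ i → ∣ i + i ∣ ≡ ∣ i ∣ ℕ.+ ∣ i ∣
  ∣i+i∣ (+ n)    = refl
  ∣i+i∣ -[1+ n ] = cong ℕ.suc (sym (ℕ.+-suc n n))

  Forbidden-double : ∀ c → Forbidden c → Forbidden (double c)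
  Forbidden-double (x , y) (y<0 , y≤-∣x∣) =
    +-mono-< y<0 y<0 , subst (y + y ≤_) (sym -∣x+x∣≡) (+-mono-≤ y≤-∣x∣ y≤-∣x∣)
    where
    -∣x+x∣≡ : - (+ ∣ x + x ∣) ≡ - (+ ∣ x ∣) + - (+ ∣ x ∣)
    -∣x+x∣≡ = trans (cong (λ n → - (+ n)) (∣i+i∣ x)) (neg-distrib-+ (+ ∣ x ∣) (+ ∣ x ∣))

  Forbidden-below-origin : Forbidden (step down origin)
  Forbidden-below-origin = -<+ , -≤+

  Forbidden-below-step : ∀ u → u ≢ up → Forbidden (step down (step u origin))
  Forbidden-below-step up    u≢up = ⊥-elim (u≢up refl)
  Forbidden-below-step down  _    = -<+ , -≤+
  Forbidden-below-step left  _    = -<+ , -≤- ℕ.z≤n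
  Forbidden-below-step right _    = -<+ , -≤- ℕ.z≤n

  height : Cell → ℤ
  height (x , y) = y + + ∣ x ∣

  height>0⇒¬Forbidden : ∀ c → + 1 ≤ height c → ¬ Forbidden c
  height>0⇒¬Forbidden (x , y) h>0 (_ , y≤-∣x∣) = <⇒≱ (+<+ (ℕ.s≤s ℕ.z≤n)) (begin
    + 1                      ≤⟨ h>0 ⟩
    y + + ∣ x ∣              ≤⟨ +-monoˡ-≤ (+ ∣ x ∣) y≤-∣x∣ ⟩
    - (+ ∣ x ∣) + + ∣ x ∣    ≡⟨ +-inverseˡ (+ ∣ x ∣) ⟩
    + 0                      ∎)
    where open ≤-Reasoning

  height-double : ∀ c → height (double c) ≡ height c + height c
  height-double (x , y) = trans (cong (λ n → (y + y) + + n) (∣i+i∣ x)) (lemma y (+ ∣ x ∣))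
    where
    lemma : ∀ y a → (y + y) + (a + a) ≡ (y + a) + (y + a)
    lemma = solve-∀

  ∣i∣≤∣i+j∣+∣j∣ : ∀ i j → ∣ i ∣ ℕ.≤ ∣ i + j ∣ ℕ.+ ∣ j ∣
  ∣i∣≤∣i+j∣+∣j∣ i j = subst₂ (λ k l → ∣ k ∣ ℕ.≤ ∣ i + j ∣ ℕ.+ l)
                            (lemma i j) (∣-i∣≡∣i∣ j) (∣i+j∣≤∣i∣+∣j∣ (i + j) (- j))
    where
    lemma : ∀ i j → (i + j) + - j ≡ i
    lemma = solve-∀

  height-step : ∀ δ c → height c - + 1 ≤ height (step δ c)
  height-step up    (x , y) =
    ≤-trans (i≤i+j (y + + ∣ x ∣ - + 1) (+ 2)) (≤-reflexive (lemma y (+ ∣ x ∣)))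
    where
    lemma : ∀ y a → ((y + a) - + 1) + + 2 ≡ (y + + 1) + a
    lemma = solve-∀
  height-step down  (x , y) = ≤-reflexive (lemma y (+ ∣ x ∣))
    where
    lemma : ∀ y a → (y + a) - + 1 ≡ (y - + 1) + a
    lemma = solve-∀
  height-step left  (x , y) = begin
    y + + ∣ x ∣ - + 1                ≤⟨ +-monoˡ-≤ (- + 1) (+-monoʳ-≤ y (+≤+ (∣i∣≤∣i+j∣+∣j∣ x (- + 1)))) ⟩
    y + (+ ∣ x - + 1 ∣ + + 1) - + 1  ≡⟨ lemma y (+ ∣ x - + 1 ∣) ⟩
    y + + ∣ x - + 1 ∣                ∎
    where
    open ≤-Reasoning
    lemma : ∀ y a → y + (a + + 1) - + 1 ≡ y + a
    lemma = solve-∀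
  height-step right (x , y) = begin
    y + + ∣ x ∣ - + 1                ≤⟨ +-monoˡ-≤ (- + 1) (+-monoʳ-≤ y (+≤+ (∣i∣≤∣i+j∣+∣j∣ x (+ 1)))) ⟩
    y + (+ ∣ x + + 1 ∣ + + 1) - + 1  ≡⟨ lemma y (+ ∣ x + + 1 ∣) ⟩
    y + + ∣ x + + 1 ∣                ∎
    where
    open ≤-Reasoning
    lemma : ∀ y a → y + (a + + 1) - + 1 ≡ y + a
    lemma = solve-∀

  height>0-double : ∀ c → + 1 ≤ height c → + 1 ≤ height (double c)
  height>0-double c h>0 = begin
    + 1                    ≤⟨ +≤+ (ℕ.s≤s ℕ.z≤n) ⟩
    + 2                    ≤⟨ +-mono-≤ h>0 h>0 ⟩
    height c + height c    ≡⟨ height-double c ⟨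
    height (double c)      ∎
    where open ≤-Reasoning

  height>0-step∘double : ∀ δ c → + 1 ≤ height c → + 1 ≤ height (step δ (double c))
  height>0-step∘double δ c h>0 = begin
    + 1                              ≡⟨⟩
    + 2 - + 1                        ≤⟨ +-monoˡ-≤ (- + 1) (+-mono-≤ h>0 h>0) ⟩
    height c + height c - + 1        ≡⟨ cong (_- + 1) (height-double c) ⟨
    height (double c) - + 1          ≤⟨ height-step δ (double c) ⟩
    height (step δ (double c))       ∎
    where open ≤-Reasoning

  height>0-step-origin : ∀ v → v ≢ down → + 1 ≤ height (step v origin)
  height>0-step-origin up    _ = ≤-refl
  height>0-step-origin down  v≢down = ⊥-elim (v≢down refl)
  height>0-step-origin left  _ = ≤-refl
  height>0-step-origin right _ = ≤-refl

module Embedding where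

  open Nim
  open Turning
  open Lattice
  open import Data.Empty using (⊥-elim)
  open import Data.Nat using (ℕ; suc; _+_; _*_; _≤_; _<_; s≤s; _≟_)
  open import Data.Nat.Properties
    using (*-cancelˡ-≡; *-suc; ≤-refl; ≤-trans; ≤-reflexive; n≤1+n; *-monoʳ-≤; *-monoʳ-<; n≢0⇒n>0)
  open import Data.Integer using (+_; +<+)
  import Data.Integer as ℤ
  open import Data.Product using (∃; _×_; _,_; proj₁)
  open import Data.Sum using (_⊎_; inj₁; inj₂)
  open import Function.Base using (_∘_)
  open import Relation.Binary.PropositionalEquality
  open import Relation.Nullary using (¬_; yes; no)

  heading : Code → Dir
  heading root      = up
  heading (even Q)  = heading Q
  heading (odd j Q) = steer (turnBetween (lastPile Q) j) (heading Q)

  cell : Code → Cell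
  cell root      = origin
  cell (even Q)  = double (cell Q)
  cell (odd j Q) = step (heading (odd j Q)) (double (cell Q))

  State : Set
  State = Cell × Dir × Pile

  state : Code → State
  state Q = cell Q , heading Q , lastPile Q

  evenState : State → State
  evenState (c , d , a) = double c , d , a

  oddState : Pile → State → State
  oddState j (c , d , a) = step (steer (turnBetween a j) d) (double c) , steer (turnBetween a j) d , j

  generation≡0⇒ : ∀ Q → generation Q ≡ 0 → state Q ≡ (origin , up , first)
  generation≡0⇒ root     _   = refl
  generation≡0⇒ (even Q) g≡0 = cong evenState (generation≡0⇒ Q (*-cancelˡ-≡ _ 0 2 g≡0))

  generation≡0⇒cell≡origin : ∀ Q → generation Q ≡ 0 → cell Q ≡ origin
  generation≡0⇒cell≡origin Q = cong proj₁ ∘ generation≡0⇒ Q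

  -- Codes are unique only up to leading zero columns (root versus even root).
  ⟦⟧≡⇒state≡ : ∀ Q R → ⟦ Q ⟧ ≡ ⟦ R ⟧ → state Q ≡ state R
  ⟦⟧≡⇒state≡ root      root      _  = refl
  ⟦⟧≡⇒state≡ root      (even R)  eq = cong evenState (⟦⟧≡⇒state≡ root R (⟦even⟧-injective root R eq))
  ⟦⟧≡⇒state≡ (even Q)  root      eq = cong evenState (⟦⟧≡⇒state≡ Q root (⟦even⟧-injective Q root eq))
  ⟦⟧≡⇒state≡ (even Q)  (even R)  eq = cong evenState (⟦⟧≡⇒state≡ Q R (⟦even⟧-injective Q R eq))
  ⟦⟧≡⇒state≡ root      (odd k R) eq = ⊥-elim (⟦even⟧≢⟦odd⟧ root k R eq)
  ⟦⟧≡⇒state≡ (even Q)  (odd k R) eq = ⊥-elim (⟦even⟧≢⟦odd⟧ Q k R eq)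
  ⟦⟧≡⇒state≡ (odd j Q) root      eq = ⊥-elim (⟦even⟧≢⟦odd⟧ root j Q (sym eq))
  ⟦⟧≡⇒state≡ (odd j Q) (even R)  eq = ⊥-elim (⟦even⟧≢⟦odd⟧ R j Q (sym eq))
  ⟦⟧≡⇒state≡ (odd j Q) (odd k R) eq with ⟦odd⟧-injective j k Q R eq
  ... | refl , ⟦Q⟧≡⟦R⟧ = cong (oddState j) (⟦⟧≡⇒state≡ Q R ⟦Q⟧≡⟦R⟧)

  ⟦⟧≡⇒cell≡ : ∀ Q R → ⟦ Q ⟧ ≡ ⟦ R ⟧ → cell Q ≡ cell R
  ⟦⟧≡⇒cell≡ Q R = cong proj₁ ∘ ⟦⟧≡⇒state≡ Q R

  heading-parentCode : ∀ Q → 0 < generation Q → heading (odd (lastPile Q) (parentCode Q)) ≡ heading Q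
  heading-parentCode (odd j Q) _   = refl
  heading-parentCode (even Q)  pos = begin
    steer (turnBetween (lastPile Q) (lastPile Q)) h  ≡⟨ cong (λ t → steer t h) (turnBetween-self (lastPile Q)) ⟩
    h                                                ≡⟨ heading-parentCode Q (0<2*n⇒0<n _ pos) ⟩
    heading Q                                        ∎
    where
    open ≡-Reasoning
    h = heading (odd (lastPile Q) (parentCode Q))

  cell-parentCode : ∀ Q → 0 < generation Q → cell (parentCode Q) ≡ step (opposite (heading Q)) (cell Q)
  cell-parentCode (odd j Q) _   = sym (step-opposite (heading (odd j Q)) (double (cell Q)))
  cell-parentCode (even Q)  pos = begin
    step (heading (odd (lastPile Q) (parentCode Q))) (double (cell (parentCode Q)))
      ≡⟨ cong₂ (λ d c → step d (double c)) (heading-parentCode Q pos′) (cell-parentCode Q pos′) ⟩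
    step d (double (step (opposite d) (cell Q)))
      ≡⟨ cong (step d) (double-step (opposite d) (cell Q)) ⟩
    step d (step (opposite d) (step (opposite d) (double (cell Q))))
      ≡⟨ step-opposite′ d _ ⟩
    step (opposite d) (double (cell Q)) ∎
    where
    open ≡-Reasoning
    d = heading Q
    pos′ = 0<2*n⇒0<n _ pos

  -- Neighbouring image cells belong to a parent and its child, the child lying along its own heading.
  Adjacent : Code → Code → Dir → Set
  Adjacent Q R δ = (δ ≡ opposite (heading R) × suc (generation Q) ≡ generation R)
                 ⊎ (δ ≡ heading Q × suc (generation R) ≡ generation Q)

  2+2*m≡2*n : ∀ {m n} → suc m ≡ n → 2 + 2 * m ≡ 2 * n
  2+2*m≡2*n {m} refl = sym (*-suc 2 m)

  mutual
    cell≡⇒generation≡ : ∀ Q R → cell Q ≡ cell R → generation Q ≡ generation R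
    cell≡⇒generation≡ Q R = ⟦⟧-generation Q R ∘ cell-injective Q R

    cell-injective : ∀ Q R → cell Q ≡ cell R → ⟦ Q ⟧ ≡ ⟦ R ⟧
    cell-injective root      root      _  = refl
    cell-injective root      (even R)  eq = cong (zeros ∷₂_) (cell-injective root R (double-injective eq))
    cell-injective (even Q)  root      eq = cong (zeros ∷₂_) (cell-injective Q root (double-injective eq))
    cell-injective (even Q)  (even R)  eq = cong (zeros ∷₂_) (cell-injective Q R (double-injective eq))
    cell-injective root      (odd k R) eq = ⊥-elim (step∘double≢double _ (cell R) origin (sym eq))
    cell-injective (even Q)  (odd k R) eq = ⊥-elim (step∘double≢double _ (cell R) (cell Q) (sym eq))
    cell-injective (odd j Q) root      eq = ⊥-elim (step∘double≢double _ (cell Q) origin eq)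
    cell-injective (odd j Q) (even R)  eq = ⊥-elim (step∘double≢double _ (cell Q) (cell R) eq)
    cell-injective (odd j Q) (odd k R) eq
      with step∘double≡step∘double⇒ (heading (odd j Q)) (cell Q) (heading (odd k R)) (cell R) eq
    ... | inj₁ (same-heading , cellQ≡cellR) = cong₂ (λ i H → pairBits i ∷₂ H) j≡k ⟦Q⟧≡⟦R⟧
      where
      ⟦Q⟧≡⟦R⟧ : ⟦ Q ⟧ ≡ ⟦ R ⟧
      ⟦Q⟧≡⟦R⟧ = cell-injective Q R cellQ≡cellR
      same-turn : steer (turnBetween (lastPile Q) j) (heading Q)
                ≡ steer (turnBetween (lastPile Q) k) (heading Q)
      same-turn = trans same-heading
        (cong (λ (_ , d , a) → steer (turnBetween a k) d) (sym (⟦⟧≡⇒state≡ Q R ⟦Q⟧≡⟦R⟧)))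
      j≡k : j ≡ k
      j≡k = turnBetween-injective (lastPile Q) j k (steer-injective (heading Q) _ _ same-turn)
    ... | inj₂ (opposite-heading , cellR≡) with cell-adjacent R Q (heading (odd j Q)) cellR≡
    ...   | inj₁ (h≡ , _) = ⊥-elim (steer≢opposite _ (heading Q) h≡)
    ...   | inj₂ (h≡ , _) =
      ⊥-elim (steer≢opposite _ (heading R) (trans opposite-heading (cong opposite h≡)))

    cell-adjacent : ∀ Q R δ → cell Q ≡ step δ (cell R) → Adjacent Q R δ
    cell-adjacent root      root      δ eq = ⊥-elim (step∘double≢double δ origin origin (sym eq))
    cell-adjacent root      (even R)  δ eq = ⊥-elim (step∘double≢double δ (cell R) origin (sym eq))
    cell-adjacent (even Q)  root      δ eq = ⊥-elim (step∘double≢double δ origin (cell Q) (sym eq))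
    cell-adjacent (even Q)  (even R)  δ eq = ⊥-elim (step∘double≢double δ (cell R) (cell Q) (sym eq))
    cell-adjacent (odd j Q) (odd k R) δ eq =
      ⊥-elim (step∘double≢step∘step∘double _ (cell Q) δ _ (cell R) eq)
    cell-adjacent root      (odd k R) δ eq
      with double≡step∘step∘double⇒ origin δ (heading (odd k R)) (cell R) eq
    ... | inj₁ (δ≡ , origin≡cellR) =
      inj₁ (δ≡ , cong (λ g → suc (2 * g)) (cell≡⇒generation≡ root R origin≡cellR))
    ... | inj₂ (_ , origin≡step) with cell-adjacent root R (heading (odd k R)) origin≡step
    ...   | inj₁ (h≡ , _) = ⊥-elim (steer≢opposite _ (heading R) h≡)
    cell-adjacent (even Q)  (odd k R) δ eq
      with double≡step∘step∘double⇒ (cell Q) δ (heading (odd k R)) (cell R) eq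
    ... | inj₁ (δ≡ , cellQ≡cellR) =
      inj₁ (δ≡ , cong (λ g → suc (2 * g)) (cell≡⇒generation≡ Q R cellQ≡cellR))
    ... | inj₂ (δ≡ , cellQ≡step) with cell-adjacent Q R (heading (odd k R)) cellQ≡step
    ...   | inj₁ (h≡ , _)  = ⊥-elim (steer≢opposite _ (heading R) h≡)
    ...   | inj₂ (h≡ , g≡) = inj₂ (trans δ≡ h≡ , 2+2*m≡2*n g≡)
    cell-adjacent (odd j Q) root      δ eq
      with step∘double≡step∘double⇒ (heading (odd j Q)) (cell Q) δ origin eq
    ... | inj₁ (u≡δ , cellQ≡origin) =
      inj₂ (sym u≡δ , cong (λ g → suc (2 * g)) (cell≡⇒generation≡ root Q (sym cellQ≡origin)))
    ... | inj₂ (_ , origin≡step) with cell-adjacent root Q (heading (odd j Q)) origin≡step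
    ...   | inj₁ (h≡ , _) = ⊥-elim (steer≢opposite _ (heading Q) h≡)
    cell-adjacent (odd j Q) (even R)  δ eq
      with step∘double≡step∘double⇒ (heading (odd j Q)) (cell Q) δ (cell R) eq
    ... | inj₁ (u≡δ , cellQ≡cellR) =
      inj₂ (sym u≡δ , cong (λ g → suc (2 * g)) (cell≡⇒generation≡ R Q (sym cellQ≡cellR)))
    ... | inj₂ (δ≡ , cellR≡step) with cell-adjacent R Q (heading (odd j Q)) cellR≡step
    ...   | inj₁ (h≡ , _)  = ⊥-elim (steer≢opposite _ (heading Q) h≡)
    ...   | inj₂ (h≡ , g≡) = inj₁ (trans δ≡ (cong opposite h≡) , 2+2*m≡2*n g≡)

  Reached : ℕ → Cell → Set
  Reached n c = ∃ λ Q → generation Q ≤ n × cell Q ≡ c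

  step∘double-reached : ∀ Q v → Reached (suc (2 * generation Q)) (step v (double (cell Q)))
                                ⊎ (generation Q ≡ 0 × v ≡ down)
  step∘double-reached Q v with steer-or-reverse (heading Q) v | generation Q ≟ 0
  ... | inj₂ (t , steer≡v) | _ =
    inj₁ (odd (shiftPile t (lastPile Q)) Q , ≤-refl , cong (λ d → step d (double (cell Q))) heading≡v)
    where
    heading≡v : steer (turnBetween (lastPile Q) (shiftPile t (lastPile Q))) (heading Q) ≡ v
    heading≡v = trans (cong (λ t → steer t (heading Q)) (turnBetween-shiftPile t (lastPile Q))) steer≡v
  ... | inj₁ v≡reverse | yes g≡0 =
    inj₂ (g≡0 , trans v≡reverse (cong (λ (_ , d , _) → opposite d) (generation≡0⇒ Q g≡0)))
  ... | inj₁ v≡reverse | no g≢0 = inj₁ (parentCode (even Q) , generation≤ , cell≡)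
    where
    pos : 0 < generation (even Q)
    pos = *-monoʳ-< 2 (n≢0⇒n>0 g≢0)
    generation≤ : generation (parentCode (even Q)) ≤ suc (2 * generation Q)
    generation≤ =
      ≤-trans (n≤1+n _) (≤-trans (≤-reflexive (generation-parentCode (even Q) pos)) (n≤1+n _))
    cell≡ : cell (parentCode (even Q)) ≡ step v (double (cell Q))
    cell≡ = trans (cell-parentCode (even Q) pos) (cong (λ d → step d (double (cell Q))) (sym v≡reverse))

  ReachedAt : ℕ → Cell → Set
  ReachedAt n c = ∃ λ Q → generation Q ≡ n × cell Q ≡ c

  Reached⇒generation≤ : ∀ Q n → Reached n (cell Q) → generation Q ≤ n
  Reached⇒generation≤ Q n (Q′ , gQ′≤n , cellQ′≡) = subst (_≤ n) (cell≡⇒generation≡ Q′ Q cellQ′≡) gQ′≤n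

  ReachedAt⇒generation≡ : ∀ Q n → ReachedAt n (cell Q) → generation Q ≡ n
  ReachedAt⇒generation≡ Q n (Q′ , gQ′≡n , cellQ′≡) = trans (sym (cell≡⇒generation≡ Q′ Q cellQ′≡)) gQ′≡n

  step∘double-reached′ : ∀ Q v → ¬ Forbidden (step v (double (cell Q))) →
                         Reached (suc (2 * generation Q)) (step v (double (cell Q)))
  step∘double-reached′ Q v allowed with step∘double-reached Q v
  ... | inj₁ reached = reached
  ... | inj₂ (g≡0 , refl) = ⊥-elim (allowed (subst (λ c → Forbidden (step down (double c)))
                                                   (sym (generation≡0⇒cell≡origin Q g≡0)) Forbidden-below-origin))

  -- Where the path turns, the cell beside it is reached from the inner side of the turn.
  beside-turn : ∀ R u v → v ≢ u → v ≢ opposite u →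
                ¬ Forbidden (step v (step u (double (cell R)))) →
                Reached (suc (2 * generation R)) (step (opposite u) (step v (step u (double (cell R)))))
  beside-turn R u v v≢u v≢reverse allowed with step∘double-reached R v
  ... | inj₁ (P , g≤ , cellP≡) = P , g≤ , trans cellP≡ (sym unturn)
    where
    unturn : step (opposite u) (step v (step u (double (cell R)))) ≡ step v (double (cell R))
    unturn = trans (cong (step (opposite u)) (step-comm u v _)) (step-opposite u _)
  ... | inj₂ (g≡0 , refl) = ⊥-elim (allowed (subst (λ c → Forbidden (step down (step u (double c))))
                                                     (sym (generation≡0⇒cell≡origin R g≡0))
                                                     (Forbidden-below-step u u≢up)))
    where
    u≢up : u ≢ up
    u≢up u≡up = v≢reverse (sym (cong opposite u≡up))

  -- A cell next to an image cell of generation n is of this kind; in the second case it has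
  -- two alive neighbours and so is never born.
  ReachedOrCrowded : ℕ → Dir → Cell → Set
  ReachedOrCrowded n w c = Reached (suc n) c ⊎ ∃ λ δ → δ ≢ w × Reached n (step δ c)

  double-ReachedOrCrowded : ∀ n w r → ¬ Forbidden (double r) →
                            ReachedOrCrowded n w r → ReachedOrCrowded (suc (2 * n)) w (double r)
  double-ReachedOrCrowded n w r _ (inj₁ (P , g≤ , cellP≡)) =
    inj₁ (even P , ≤-trans (*-monoʳ-≤ 2 g≤) (≤-reflexive (*-suc 2 n)) , cong double cellP≡)
  double-ReachedOrCrowded n w r allowed (inj₂ (δ , δ≢ , R , g≤ , cellR≡))
    with step∘double-reached R (opposite δ)
  ... | inj₁ (P , g≤′ , cellP≡) =
    inj₂ (δ , δ≢ , P , ≤-trans g≤′ (s≤s (*-monoʳ-≤ 2 g≤)) , trans cellP≡ beside)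
    where
    beside : step (opposite δ) (double (cell R)) ≡ step δ (double r)
    beside = begin
      step (opposite δ) (double (cell R))             ≡⟨ cong (step (opposite δ) ∘ double) cellR≡ ⟩
      step (opposite δ) (double (step δ r))           ≡⟨ cong (step (opposite δ)) (double-step δ r) ⟩
      step (opposite δ) (step δ (step δ (double r)))  ≡⟨ step-opposite δ _ ⟩
      step δ (double r)                               ∎
      where open ≡-Reasoning
  ... | inj₂ (g≡0 , δ′≡down) = ⊥-elim (allowed (subst (Forbidden ∘ double) below
                                                     (Forbidden-double (step down origin) Forbidden-below-origin)))
    where
    below : step down origin ≡ r
    below = begin
      step down origin                     ≡⟨ cong (step down) (generation≡0⇒cell≡origin R g≡0) ⟨
      step down (cell R)                   ≡⟨ cong (step down) cellR≡ ⟩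
      step down (step δ r)                 ≡⟨ cong (λ d → step down (step d r)) (opposite-injective δ′≡down) ⟩
      step down (step up r)                ≡⟨ step-opposite up r ⟩
      r                                    ∎
      where open ≡-Reasoning

  reached-neighbour : ∀ R v c → ¬ Forbidden c → c ≡ step v (cell R) →
                      ReachedOrCrowded (generation R) (opposite v) c
  reached-neighbour root     v _ allowed refl = inj₁ (step∘double-reached′ root v allowed)
  reached-neighbour (even R) v _ allowed refl = inj₁ (step∘double-reached′ R v allowed)
  reached-neighbour (odd j R) v _ allowed refl with steer-or-reverse (heading (odd j R)) v
  ... | inj₁ refl =
    inj₁ (even R , ≤-trans (n≤1+n _) (n≤1+n _) , sym (step-opposite _ (double (cell R))))
  ... | inj₂ (straight , refl) =
    subst (ReachedOrCrowded (generation (odd j R)) (opposite u)) (double-step u r)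
          (double-ReachedOrCrowded (generation R) (opposite u) (step u r) allowed′
            (reached-neighbour R u (step u r) (allowed′ ∘ Forbidden-double (step u r)) refl))
    where
    u = heading (odd j R)
    r = cell R
    allowed′ : ¬ Forbidden (double (step u r))
    allowed′ = allowed ∘ subst Forbidden (double-step u r)
  ... | inj₂ (leftward  , refl) =
    inj₂ (opposite u , opposite-≢ (≢-sym (leftward≢straight u)) ,
          beside-turn R u _ (leftward≢straight u) (steer≢opposite leftward u) allowed)
    where u = heading (odd j R)
  ... | inj₂ (rightward , refl) =
    inj₂ (opposite u , opposite-≢ (≢-sym (rightward≢straight u)) ,
          beside-turn R u _ (rightward≢straight u) (steer≢opposite rightward u) allowed)
    where u = heading (odd j R)

  cell-height : ∀ Q → 0 < generation Q → + 1 ℤ.≤ height (cell Q)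
  cell-height (even Q)  pos = height>0-double (cell Q) (cell-height Q (0<2*n⇒0<n _ pos))
  cell-height (odd j Q) _ with generation Q ≟ 0
  ... | yes g≡0 = subst (λ (c , d , a) → + 1 ℤ.≤ height (step (steer (turnBetween a j) d) (double c)))
                        (sym (generation≡0⇒ Q g≡0))
                        (height>0-step-origin (steer t up) (steer≢opposite t up))
    where t = turnBetween first j
  ... | no g≢0  = height>0-step∘double (heading (odd j Q)) (cell Q) (cell-height Q (n≢0⇒n>0 g≢0))

  cell-allowed : ∀ Q → ¬ Forbidden (cell Q)
  cell-allowed Q with generation Q ≟ 0
  ... | yes g≡0 = subst (¬_ ∘ Forbidden) (sym (generation≡0⇒cell≡origin Q g≡0)) λ { (+<+ () , _) }
  ... | no g≢0  = height>0⇒¬Forbidden (cell Q) (cell-height Q (n≢0⇒n>0 g≢0))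

module Automaton where

  open Nim
  open Turning
  open Lattice
  open Embedding
  open import Data.Empty using (⊥-elim)
  open import Data.Nat using (ℕ; zero; suc; _≤_; _<_; z≤n; s≤s; _≤?_)
  open import Data.Nat.Properties
    using (≤-trans; ≤-reflexive; ≤-antisym; ≰⇒>; m≤n⇒m≤1+n; 1+n≰n; n≤0⇒n≡0; n≤1+n; suc-injective)
  open import Data.Product using (_,_; proj₁)
  open import Data.Sum using (inj₁; inj₂)
  open import Function.Bundles using (_⇔_; mk⇔; Equivalence)
  open import Relation.Binary.PropositionalEquality
  open import Relation.Nullary using (¬_; yes; no)

  open Equivalence using (to; from)

  module _ (n : ℕ) (alive⇔ : ∀ c → AliveBy n c ⇔ Reached n c) where

    born-step : ∀ c → BornAt (suc n) c ⇔ ReachedAt (suc n) c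
    born-step c = mk⇔ born⇒ ⇒born
      where
      born⇒ : BornAt (suc n) c → ReachedAt (suc n) c
      born⇒ (dead , allowed , δ , alive , unique) with to (alive⇔ (step δ c)) alive
      ... | R , gR≤n , cellR≡ with reached-neighbour R (opposite δ) c allowed c≡
        where
        c≡ : c ≡ step (opposite δ) (cell R)
        c≡ = trans (sym (step-opposite δ c)) (cong (step (opposite δ)) (sym cellR≡))
      ... | inj₂ (δ′ , δ′≢ , R′ , gR′≤ , cellR′≡) =
        ⊥-elim (δ′≢ (trans (unique δ′ (from (alive⇔ _) (R′ , ≤-trans gR′≤ gR≤n , cellR′≡)))
                           (sym (opposite-involutive δ))))
      ... | inj₁ (P , gP≤ , cellP≡) with generation P ≤? n
      ...   | yes gP≤n = ⊥-elim (dead (from (alive⇔ c) (P , gP≤n , cellP≡)))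
      ...   | no  gP≰n = P , ≤-antisym (≤-trans gP≤ (s≤s gR≤n)) (≰⇒> gP≰n) , cellP≡

      ⇒born : ReachedAt (suc n) c → BornAt (suc n) c
      ⇒born (Q , gQ≡ , refl) = dead , cell-allowed Q , opposite (heading Q) , alive , unique
        where
        pos : 0 < generation Q
        pos = subst (0 <_) (sym gQ≡) (s≤s z≤n)
        dead : ¬ AliveBy n (cell Q)
        dead alive = 1+n≰n (subst (_≤ n) gQ≡ (Reached⇒generation≤ Q n (to (alive⇔ (cell Q)) alive)))
        alive : AliveBy n (step (opposite (heading Q)) (cell Q))
        alive = from (alive⇔ _) (parentCode Q , ≤-reflexive parent-generation , cell-parentCode Q pos)
          where
          parent-generation = suc-injective (trans (generation-parentCode Q pos) gQ≡)
        unique : ∀ δ → AliveBy n (step δ (cell Q)) → δ ≡ opposite (heading Q)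
        unique δ alive with to (alive⇔ _) alive
        ... | Q′ , gQ′≤n , cellQ′≡ with cell-adjacent Q′ Q δ cellQ′≡
        ...   | inj₁ (δ≡ , _)  = δ≡
        ...   | inj₂ (_ , g≡) =
          ⊥-elim (1+n≰n (≤-trans (n≤1+n (suc n)) (subst (_≤ n) (trans (sym g≡) (cong suc gQ≡)) gQ′≤n)))

    alive-step : ∀ c → AliveBy (suc n) c ⇔ Reached (suc n) c
    alive-step c = mk⇔ alive⇒ ⇒alive
      where
      alive⇒ : AliveBy (suc n) c → Reached (suc n) c
      alive⇒ (inj₁ alive) with to (alive⇔ c) alive
      ... | Q , gQ≤n , cellQ≡ = Q , m≤n⇒m≤1+n gQ≤n , cellQ≡
      alive⇒ (inj₂ born) with to (born-step c) born
      ... | Q , gQ≡ , cellQ≡ = Q , ≤-reflexive gQ≡ , cellQ≡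
      ⇒alive : Reached (suc n) c → AliveBy (suc n) c
      ⇒alive (Q , gQ≤ , cellQ≡) with generation Q ≤? n
      ... | yes gQ≤n = inj₁ (from (alive⇔ c) (Q , gQ≤n , cellQ≡))
      ... | no  gQ≰n = inj₂ (from (born-step c) (Q , ≤-antisym gQ≤ (≰⇒> gQ≰n) , cellQ≡))

  AliveBy⇔Reached : ∀ n c → AliveBy n c ⇔ Reached n c
  AliveBy⇔Reached zero    c = mk⇔ (λ c≡origin → root , z≤n , sym c≡origin)
    (λ (Q , gQ≤0 , cellQ≡) → trans (sym cellQ≡) (generation≡0⇒cell≡origin Q (n≤0⇒n≡0 gQ≤0)))
  AliveBy⇔Reached (suc n) = alive-step n (AliveBy⇔Reached n)

  BornAt⇔ReachedAt : ∀ n c → BornAt n c ⇔ ReachedAt n c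
  BornAt⇔ReachedAt zero    c = mk⇔ (λ c≡origin → root , refl , sym c≡origin)
    (λ (Q , gQ≡0 , cellQ≡) → trans (sym cellQ≡) (generation≡0⇒cell≡origin Q gQ≡0))
  BornAt⇔ReachedAt (suc n) = born-step n (AliveBy⇔Reached n)

open import Data.Nat using (suc; _≤_; _<_; s≤s; z≤n)
open import Data.Nat.Properties using (≤-reflexive; 1+n≰n; ≤-trans; n≤1+n)
open import Data.Empty using (⊥-elim)
open import Data.Sum using (inj₁; inj₂)
open import Function.Bundles using (mk⇔; Equivalence)
open import Function.Properties.Equivalence
  using () renaming (refl to ⇔-refl; trans to ⇔-trans; sym to ⇔-sym)
open import Relation.Binary.PropositionalEquality

open Nim
open Turning
open Embedding
open Automaton

open Equivalence using (to; from)

ParentCode : Code → Code → Set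
ParentCode Q₁ Q₂ = ⟦ Q₁ ⟧ ≡ ⟦ parentCode Q₂ ⟧ × 0 < generation Q₂

NimParent⇔ParentCode : ∀ Q₁ Q₂ → NimParent ⟦ Q₁ ⟧ ⟦ Q₂ ⟧ ⇔ ParentCode Q₁ Q₂
NimParent⇔ParentCode Q₁ Q₂ = ⇔-trans (NimParent⇔grow ⟦ Q₁ ⟧ ⟦ Q₂ ⟧) (mk⇔ grow⇒ ⇒grow)
  where
  grow⇒ : (∃ λ j → ⟦ Q₂ ⟧ ≡ grow j ⟦ Q₁ ⟧) → ParentCode Q₁ Q₂
  grow⇒ (j , eq) with grow⇒parentCode Q₂ j ⟦ Q₁ ⟧ (IsP-⟦⟧ Q₁) (sym eq)
  ... | ⟦Q₁⟧≡ , _ , pos = ⟦Q₁⟧≡ , pos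
  ⇒grow : ParentCode Q₁ Q₂ → ∃ λ j → ⟦ Q₂ ⟧ ≡ grow j ⟦ Q₁ ⟧
  ⇒grow (⟦Q₁⟧≡ , pos) =
    lastPile Q₂ , trans (⟦⟧≡grow-parentCode Q₂ pos) (cong (grow (lastPile Q₂)) (sym ⟦Q₁⟧≡))

CAParent⇔ParentCode : ∀ Q₁ Q₂ → CAParent (cell Q₁) (cell Q₂) ⇔ ParentCode Q₁ Q₂
CAParent⇔ParentCode Q₁ Q₂ = mk⇔ parent⇒ ⇒parent
  where
  parent⇒ : CAParent (cell Q₁) (cell Q₂) → ParentCode Q₁ Q₂
  parent⇒ (n , born , alive , δ , cellQ₁≡) with cell-adjacent Q₁ Q₂ δ (sym cellQ₁≡)
  ... | inj₁ (refl , g≡) = cell-injective Q₁ (parentCode Q₂) cellQ₁≡′ , pos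
    where
    pos : 0 < generation Q₂
    pos = subst (0 <_) g≡ (s≤s z≤n)
    cellQ₁≡′ : cell Q₁ ≡ cell (parentCode Q₂)
    cellQ₁≡′ = trans (sym cellQ₁≡) (sym (cell-parentCode Q₂ pos))
  ... | inj₂ (_ , g≡) = ⊥-elim (1+n≰n (≤-trans (n≤1+n (suc n)) (subst (_≤ n) gQ₁≡ gQ₁≤n)))
    where
    gQ₁≤n : generation Q₁ ≤ n
    gQ₁≤n = Reached⇒generation≤ Q₁ n (to (AliveBy⇔Reached n _) alive)
    gQ₁≡ : generation Q₁ ≡ suc (suc n)
    gQ₁≡ = trans (sym g≡) (cong suc (ReachedAt⇒generation≡ Q₂ (suc n) (to (BornAt⇔ReachedAt (suc n) _) born)))
  ⇒parent : ParentCode Q₁ Q₂ → CAParent (cell Q₁) (cell Q₂)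
  ⇒parent (⟦Q₁⟧≡ , pos) =
    generation (parentCode Q₂) , born , alive , opposite (heading Q₂) , sym cellQ₁≡
    where
    cellQ₁≡ : cell Q₁ ≡ step (opposite (heading Q₂)) (cell Q₂)
    cellQ₁≡ = trans (⟦⟧≡⇒cell≡ Q₁ (parentCode Q₂) ⟦Q₁⟧≡) (cell-parentCode Q₂ pos)
    born : BornAt (suc (generation (parentCode Q₂))) (cell Q₂)
    born = from (BornAt⇔ReachedAt _ _) (Q₂ , sym (generation-parentCode Q₂ pos) , refl)
    alive : AliveBy (generation (parentCode Q₂)) (cell Q₁)
    alive = from (AliveBy⇔Reached _ _)
                 (Q₁ , ≤-reflexive (⟦⟧-generation Q₁ (parentCode Q₂) ⟦Q₁⟧≡) , refl)

Φ : Pos → Cell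
Φ P = cell (code P)

Φ-born : ∀ P n → IsP P → total P ≡ 2 * n → BornAt n (Φ P)
Φ-born P n isP eq = from (BornAt⇔ReachedAt n (Φ P)) (code P , generation-code P n isP eq , refl)

Φ-alive : ∀ P → IsP P → Alive (Φ P)
Φ-alive P _ = generation (code P) , from (BornAt⇔ReachedAt _ (Φ P)) (code P , refl , refl)

Φ-injective : ∀ P Q → IsP P → IsP Q → Φ P ≡ Φ Q → P ≡ Q
Φ-injective P Q isP isQ eq =
  trans (sym (⟦code⟧ P isP)) (trans (cell-injective (code P) (code Q) eq) (⟦code⟧ Q isQ))

Φ-surjective : ∀ c → Alive c → ∃ λ P → IsP P × Φ P ≡ c
Φ-surjective c (n , born) with to (BornAt⇔ReachedAt n c) born
... | Q , _ , refl = ⟦ Q ⟧ , IsP-⟦⟧ Q , ⟦⟧≡⇒cell≡ (code ⟦ Q ⟧) Q (⟦code⟧ ⟦ Q ⟧ (IsP-⟦⟧ Q))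

Φ-parent : ∀ P₁ P₂ → IsP P₁ → IsP P₂ → NimParent P₁ P₂ ⇔ CAParent (Φ P₁) (Φ P₂)
Φ-parent P₁ P₂ isP₁ isP₂ =
  ⇔-trans decoded (⇔-trans (NimParent⇔ParentCode Q₁ Q₂) (⇔-sym (CAParent⇔ParentCode Q₁ Q₂)))
  where
  Q₁ = code P₁
  Q₂ = code P₂
  decoded : NimParent P₁ P₂ ⇔ NimParent ⟦ Q₁ ⟧ ⟦ Q₂ ⟧
  decoded = subst₂ (λ A B → NimParent A B ⇔ NimParent ⟦ Q₁ ⟧ ⟦ Q₂ ⟧) (⟦code⟧ P₁ isP₁) (⟦code⟧ P₂ isP₂) ⇔-refl

theorem25 :
    Σ (Pos → Cell) λ Φ →
        (∀ P → IsP P → Alive (Φ P))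
      × (∀ P Q → IsP P → IsP Q → Φ P ≡ Φ Q → P ≡ Q)
      × (∀ c → Alive c → ∃ λ P → IsP P × Φ P ≡ c)
      × (∀ P n → IsP P → total P ≡ 2 * n → BornAt n (Φ P))
      × (∀ P₁ P₂ → IsP P₁ → IsP P₂ → (NimParent P₁ P₂ ⇔ CAParent (Φ P₁) (Φ P₂)))
theorem25 = Φ , Φ-alive , Φ-injective , Φ-surjective , Φ-born , Φ-parent
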